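{- Let $T$ be an increasing shifted tableau of shape $\lambda$ such that $\mathfrak{row}(T)$ is an FPF-involution word. Then all entries on the main diagonal of $T$ are even.
   Context: Let $s_i$ be the simple transposition $(i\ i{+}1)$, $\mathfrak S_\infty$ the finitely supported permutations of $\{1,2,\dots\}$, $\Theta=(1\,2)(3\,4)\cdots$, $\mathfrak F_\infty=\{\pi^{ -1}\Theta\pi:\pi\in\mathfrak S_\infty\}$. A word $i_1\cdots i_l$ of positive integers is an FPF-involution word if for some $z\in\mathfrak F_\infty$ we have $z=s_{i_l}\cdots s_{i_1}\Theta s_{i_1}\cdots s_{i_l}$ and $l$ is minimal among words with this property. For a strict partition $\lambda=(\lambda_1>\cdots>\lambda_l>0)$ the shifted diagram is $S(\lambda)=\{(i,j):1\le i\le l,\ i\le j\le\lambda_i+i-1\}$, with main diagonal the boxes $(i,i)$. An increasing shifted tableau of shape $\lambda$ is a filling of $S(\lambda)$ by positive integers strictly increasing along rows and down columns. Its row reading word $\mathfrak{row}(T)$ is $T_lT_{l-1}\cdots T_1$, where $T_i$ is the $i$th row read left to right. -}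

module Defs where

open import Data.Nat using (ℕ; zero; suc; _+_; _≤_; _<_; _>_; _≟_)
open import Data.Nat.Divisibility using (_∣_)
open import Data.List using (List; []; _∷_; length; map; concat; reverse)
open import Data.List.Relation.Unary.All using (All)
open import Data.List.Relation.Unary.Linked using (Linked)
open import Data.Product using (_×_)
open import Data.Unit using (⊤)
open import Data.Empty using (⊥)
open import Relation.Nullary using (yes; no)
open import Relation.Binary.PropositionalEquality using (_≡_)

-- Permutations of the positive integers are modelled as functions ℕ → ℕ
-- (the value at 0 is irrelevant; all maps below fix 0).

s : ℕ → ℕ → ℕ
s i n with n ≟ i
... | yes _ = suc i
... | no _ with n ≟ suc i
...   | yes _ = i
...   | no _ = n

-- Θ = (1 2)(3 4)(5 6) ⋯
Θ : ℕ → ℕ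
Θ zero = zero
Θ (suc zero) = 2
Θ (suc (suc zero)) = 1
Θ (suc (suc (suc n))) = 2 + Θ (suc n)

-- conjAux z (i₁ ⋯ iₗ) = s_{iₗ} ⋯ s_{i₁} z s_{i₁} ⋯ s_{iₗ}
conjAux : (ℕ → ℕ) → List ℕ → (ℕ → ℕ)
conjAux z [] = z
conjAux z (i ∷ w) = conjAux (λ n → s i (z (s i n))) w

conjΘ : List ℕ → (ℕ → ℕ)
conjΘ = conjAux Θ

_≐_ : (ℕ → ℕ) → (ℕ → ℕ) → Set
f ≐ g = ∀ n → 1 ≤ n → f n ≡ g n

PosWord : List ℕ → Set
PosWord = All (1 ≤_)

FPFInvWord : List ℕ → Set
FPFInvWord w = PosWord w ×
  (∀ v → PosWord v → conjΘ v ≐ conjΘ w → length w ≤ length v)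

StrictPartition : List ℕ → Set
StrictPartition lam = Linked _>_ lam × All (0 <_) lam

-- A shifted tableau of shape λ is given by its list of rows T₁, …, Tₗ;
-- row i lists the entries of boxes (i,i), (i,i+1), …, (i,λᵢ+i-1).
-- Column condition between consecutive rows: box (i+1,j) lies under (i,j),
-- i.e. the k-th entry of row i+1 lies under the (k+1)-st entry of row i.
ColAligned : List ℕ → List ℕ → Set
ColAligned _ [] = ⊤
ColAligned [] (_ ∷ _) = ⊥
ColAligned (b ∷ up) (c ∷ low) = (b < c) × ColAligned up low

ColIncr : List ℕ → List ℕ → Set
ColIncr [] low = ColAligned [] low
ColIncr (_ ∷ up) low = ColAligned up low

ColumnsIncreasing : List (List ℕ) → Set
ColumnsIncreasing [] = ⊤
ColumnsIncreasing (r ∷ []) = ⊤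
ColumnsIncreasing (r ∷ r' ∷ rs) = ColIncr r r' × ColumnsIncreasing (r' ∷ rs)

IncreasingShiftedTableau : List ℕ → List (List ℕ) → Set
IncreasingShiftedTableau lam T =
  StrictPartition lam × map length T ≡ lam ×
  All (All (1 ≤_)) T × All (Linked _<_) T × ColumnsIncreasing T

rowWord : List (List ℕ) → List ℕ
rowWord T = concat (reverse T)

-- the first entry of a row is its main-diagonal entry
DiagEven : List ℕ → Set
DiagEven [] = ⊤
DiagEven (x ∷ _) = 2 ∣ x

module Submission where

-- Let x be the diagonal entry of some row of T and write
-- row(T) = A ++ x ∷ B, where A is the reading word of the rows below.
-- Every letter of A is at least x + 2: entries to the right of x in its
-- row exceed x, and each step down a column increases entries further.
-- Hence conjugating Θ by the letters of A never moves x or x + 1.  If x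
-- were odd, Θ swaps x and x + 1, so the prefix involution z = conjΘ A
-- still swaps them, and then s_x z s_x = z: the letter x could be deleted
-- from the word without changing the involution, contradicting minimality.

open import Defs
open import Data.Nat using (ℕ; zero; suc; _*_; _≤_; _<_; _≟_; z≤n; s≤s)
open import Data.Nat.Properties
  using (≤-refl; <-trans; <⇒≤; <⇒≢; <⇒≱; ≤-<-trans; m<n⇒m<1+n; n<1+n)
open import Data.Nat.Divisibility using (_∣_; divides)
open import Data.List using (List; []; _∷_; _++_; concat; reverse; length; drop; [_])
open import Data.List.Properties using (concat-++; unfold-reverse; ++-identityʳ; ++-assoc)
open import Data.List.Relation.Unary.All using (All; []; _∷_; tail) renaming (map to all-map)
open import Data.List.Relation.Unary.All.Properties using (++⁺; ++⁻ˡ; ++⁻ʳ; concat⁺; drop⁺)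
open import Data.List.Relation.Unary.Linked using (Linked; _∷_)
open import Data.List.Relation.Unary.Linked.Properties using (Linked⇒All)
open import Data.List.Relation.Binary.Permutation.Propositional using (↭-sym)
open import Data.List.Relation.Binary.Permutation.Propositional.Properties
  using (↭-reverse; All-resp-↭)
open import Data.Product using (Σ; _,_)
open import Data.Sum using (_⊎_; inj₁; inj₂)
open import Data.Empty using (⊥-elim)
open import Data.Unit using (tt)
open import Relation.Nullary using (yes; no; ¬_)
open import Relation.Binary.PropositionalEquality
  using (_≡_; _≢_; refl; sym; trans; cong; cong-app; subst; module ≡-Reasoning)
open ≡-Reasoning

s-at : ∀ j → s j j ≡ suc j
s-at j with j ≟ j
... | yes _ = refl
... | no j≢j = ⊥-elim (j≢j refl)

s-at-suc : ∀ j → s j (suc j) ≡ j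
s-at-suc j with suc j ≟ j
... | yes e = ⊥-elim (<⇒≢ (n<1+n j) (sym e))
... | no _ with suc j ≟ suc j
...   | yes _ = refl
...   | no ne = ⊥-elim (ne refl)

s-fix : ∀ j n → n ≢ j → n ≢ suc j → s j n ≡ n
s-fix j n n≢j n≢sj with n ≟ j
... | yes e = ⊥-elim (n≢j e)
... | no _ with n ≟ suc j
...   | yes e = ⊥-elim (n≢sj e)
...   | no _ = refl

s-fix-below : ∀ j n → n < j → s j n ≡ n
s-fix-below j n n<j = s-fix j n (<⇒≢ n<j) (<⇒≢ (m<n⇒m<1+n n<j))

data Position (j n : ℕ) : Set where
  at-j     : n ≡ j → Position j n
  at-suc-j : n ≡ suc j → Position j n
  off      : n ≢ j → n ≢ suc j → Position j n

position : ∀ j n → Position j n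
position j n with n ≟ j | n ≟ suc j
... | yes n≡j | _ = at-j n≡j
... | no _ | yes n≡sj = at-suc-j n≡sj
... | no n≢j | no n≢sj = off n≢j n≢sj

s-involutive : ∀ j n → s j (s j n) ≡ n
s-involutive j n with position j n
... | at-j refl = trans (cong (s j) (s-at j)) (s-at-suc j)
... | at-suc-j refl = trans (cong (s j) (s-at-suc j)) (s-at j)
... | off n≢j n≢sj =
  trans (cong (s j) (s-fix j n n≢j n≢sj)) (s-fix j n n≢j n≢sj)

Involution : (ℕ → ℕ) → Set
Involution z = ∀ n → z (z n) ≡ n

record Swaps (d : ℕ) (z : ℕ → ℕ) : Set where
  constructor swaps
  field
    involutive : Involution z
    forth      : z d ≡ suc d

swaps-back : ∀ {d z} → Swaps d z → z (suc d) ≡ d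
swaps-back {d} {z} (swaps inv zd) = trans (cong z (sym zd)) (inv d)

conjBy : ℕ → (ℕ → ℕ) → (ℕ → ℕ)
conjBy j z n = s j (z (s j n))

conjBy-involution : ∀ j z → Involution z → Involution (conjBy j z)
conjBy-involution j z inv n = begin
  s j (z (s j (s j (z (s j n))))) ≡⟨ cong (λ m → s j (z m)) (s-involutive j _) ⟩
  s j (z (z (s j n)))             ≡⟨ cong (s j) (inv _) ⟩
  s j (s j n)                     ≡⟨ s-involutive j n ⟩
  n                               ∎

conjBy-large-swaps : ∀ {d z} j → suc d < j → Swaps d z → Swaps d (conjBy j z)
conjBy-large-swaps {d} {z} j sd<j (swaps inv zd) = swaps (conjBy-involution j z inv) fixes
  where
  fixes : s j (z (s j d)) ≡ suc d
  fixes = begin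
    s j (z (s j d)) ≡⟨ cong (λ m → s j (z m)) (s-fix-below j d (<-trans (n<1+n d) sd<j)) ⟩
    s j (z d)       ≡⟨ cong (s j) zd ⟩
    s j (suc d)     ≡⟨ s-fix-below j (suc d) sd<j ⟩
    suc d           ∎

conjBy-own-cycle : ∀ {d z} → Swaps d z → ∀ n → conjBy d z n ≡ z n
conjBy-own-cycle {d} {z} sw@(swaps inv zd) n with position d n
... | at-j refl = begin
  s d (z (s d d)) ≡⟨ cong (λ m → s d (z m)) (s-at d) ⟩
  s d (z (suc d)) ≡⟨ cong (s d) (swaps-back sw) ⟩
  s d d           ≡⟨ s-at d ⟩
  suc d           ≡⟨ sym zd ⟩
  z d             ∎
... | at-suc-j refl = begin
  s d (z (s d (suc d))) ≡⟨ cong (λ m → s d (z m)) (s-at-suc d) ⟩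
  s d (z d)             ≡⟨ cong (s d) zd ⟩
  s d (suc d)           ≡⟨ s-at-suc d ⟩
  d                     ≡⟨ sym (swaps-back sw) ⟩
  z (suc d)             ∎
... | off n≢d n≢sd = begin
  s d (z (s d n)) ≡⟨ cong (λ m → s d (z m)) (s-fix d n n≢d n≢sd) ⟩
  s d (z n)       ≡⟨ s-fix d (z n) zn≢d zn≢sd ⟩
  z n             ∎
  where
  zn≢d : z n ≢ d
  zn≢d e = n≢sd (trans (sym (inv n)) (trans (cong z e) zd))
  zn≢sd : z n ≢ suc d
  zn≢sd e = n≢d (trans (sym (inv n)) (trans (cong z e) (swaps-back sw)))

conjAux-cong : ∀ {f g} → (∀ n → f n ≡ g n) → ∀ w n → conjAux f w n ≡ conjAux g w n
conjAux-cong f≗g [] n = f≗g n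
conjAux-cong f≗g (i ∷ w) n = conjAux-cong (λ m → cong (s i) (f≗g (s i m))) w n

conjAux-++ : ∀ z A B → conjAux z (A ++ B) ≡ conjAux (conjAux z A) B
conjAux-++ z [] B = refl
conjAux-++ z (i ∷ A) B = conjAux-++ (conjBy i z) A B

conjAux-large-swaps : ∀ {d z} A → All (suc d <_) A → Swaps d z → Swaps d (conjAux z A)
conjAux-large-swaps [] [] sw = sw
conjAux-large-swaps (j ∷ A) (sd<j ∷ bounds) sw =
  conjAux-large-swaps A bounds (conjBy-large-swaps j sd<j sw)

Θ-shift : ∀ m → 1 ≤ m → Θ (suc (suc m)) ≡ suc (suc (Θ m))
Θ-shift (suc m) (s≤s _) = refl

Θ-positive : ∀ n → 1 ≤ Θ (suc n)
Θ-positive zero = s≤s z≤n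
Θ-positive (suc zero) = s≤s z≤n
Θ-positive (suc (suc n)) = s≤s z≤n

Θ-involutive : Involution Θ
Θ-involutive zero = refl
Θ-involutive (suc zero) = refl
Θ-involutive (suc (suc zero)) = refl
Θ-involutive (suc (suc (suc n))) = begin
  Θ (suc (suc (Θ (suc n)))) ≡⟨ Θ-shift (Θ (suc n)) (Θ-positive n) ⟩
  suc (suc (Θ (Θ (suc n)))) ≡⟨ cong (λ m → suc (suc m)) (Θ-involutive (suc n)) ⟩
  suc (suc (suc n))         ∎

Θ-swaps-odd : ∀ k → Swaps (suc (k * 2)) Θ
Θ-swaps-odd k = swaps Θ-involutive (Θ-odd k)
  where
  Θ-odd : ∀ i → Θ (suc (i * 2)) ≡ suc (suc (i * 2))
  Θ-odd zero = refl
  Θ-odd (suc i) = cong (λ m → suc (suc m)) (Θ-odd i)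

parity : ∀ n → 2 ∣ n ⊎ Σ ℕ (λ k → n ≡ suc (k * 2))
parity zero = inj₁ (divides 0 refl)
parity (suc zero) = inj₂ (0 , refl)
parity (suc (suc n)) with parity n
... | inj₁ (divides k n≡2k) = inj₁ (divides (suc k) (cong (λ m → suc (suc m)) n≡2k))
... | inj₂ (k , n≡2k+1) = inj₂ (suc k , cong (λ m → suc (suc m)) n≡2k+1)

length-delete : ∀ {X : Set} (A B : List X) d → length (A ++ B) < length (A ++ d ∷ B)
length-delete [] B d = ≤-refl
length-delete (_ ∷ A) B d = s≤s (length-delete A B d)

-- A letter d whose prefix involution has the 2-cycle (d d+1) can be deleted
-- without changing the involution, so it cannot occur in a minimal word.
redundant-letter : ∀ d A B → Swaps d (conjΘ A) → ¬ FPFInvWord (A ++ d ∷ B)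
redundant-letter d A B sw (positive , minimal) =
  <⇒≱ (length-delete A B d) (minimal (A ++ B) positive′ same-involution)
  where
  positive′ : PosWord (A ++ B)
  positive′ = ++⁺ (++⁻ˡ A positive) (tail (++⁻ʳ A positive))
  same-involution : conjΘ (A ++ B) ≐ conjΘ (A ++ d ∷ B)
  same-involution n _ = begin
    conjΘ (A ++ B) n                 ≡⟨ cong-app (conjAux-++ Θ A B) n ⟩
    conjAux (conjΘ A) B n            ≡⟨ conjAux-cong (λ m → sym (conjBy-own-cycle sw m)) B n ⟩
    conjAux (conjBy d (conjΘ A)) B n ≡⟨ cong-app (sym (conjAux-++ Θ A (d ∷ B))) n ⟩
    conjΘ (A ++ d ∷ B) n             ∎

letter-after-large-letters-even : ∀ x A B → All (suc x <_) A → FPFInvWord (A ++ x ∷ B) → 2 ∣ x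
letter-after-large-letters-even x A B bounds fpf with parity x
... | inj₁ even = even
... | inj₂ (k , refl) =
  ⊥-elim (redundant-letter x A B (conjAux-large-swaps A bounds (Θ-swaps-odd k)) fpf)

row-exceeds-head : ∀ {x} rt → Linked _<_ (x ∷ rt) → All (x <_) rt
row-exceeds-head [] _ = []
row-exceeds-head (y ∷ rt) (x<y ∷ increasing) = Linked⇒All <-trans x<y increasing

column-step : ∀ {c} up low → All (c ≤_) up → ColAligned up low → All (c <_) low
column-step up [] _ _ = []
column-step (b ∷ up) (e ∷ low) (c≤b ∷ bounds) (b<e , aligned) =
  ≤-<-trans c≤b b<e ∷ column-step up low bounds aligned

colIncr-aligned : ∀ r low → ColIncr r low → ColAligned (drop 1 r) low
colIncr-aligned [] low aligned = aligned
colIncr-aligned (_ ∷ _) low aligned = aligned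

rows-below : ∀ {c} r rs → All (c ≤_) (drop 1 r) → ColumnsIncreasing (r ∷ rs) →
  All (All (c <_)) rs
rows-below r [] _ _ = []
rows-below {c} r (r′ ∷ rs) bounds (incr , columns) =
  below ∷ rows-below r′ rs (all-map <⇒≤ (drop⁺ 1 below)) columns
  where
  below : All (c <_) r′
  below = column-step (drop 1 r) r′ bounds (colIncr-aligned r r′ incr)

columns-tail : ∀ r rs → ColumnsIncreasing (r ∷ rs) → ColumnsIncreasing rs
columns-tail r [] _ = tt
columns-tail r (_ ∷ _) (_ , columns) = columns

rowWord-∷ : ∀ r rs → rowWord (r ∷ rs) ≡ rowWord rs ++ r
rowWord-∷ r rs = begin
  concat (reverse (r ∷ rs))    ≡⟨ cong concat (unfold-reverse r rs) ⟩
  concat (reverse rs ++ [ r ]) ≡⟨ sym (concat-++ (reverse rs) [ r ]) ⟩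
  rowWord rs ++ r ++ []        ≡⟨ cong (rowWord rs ++_) (++-identityʳ r) ⟩
  rowWord rs ++ r              ∎

all-rowWord : ∀ {P : ℕ → Set} T → All (All P) T → All P (rowWord T)
all-rowWord T all = concat⁺ (All-resp-↭ (↭-sym (↭-reverse T)) all)

-- The diagonal entry x of a row is read after the rows below it, all of
-- whose entries are ≥ x + 2.
diagonal-entry-even : ∀ r rs S → Linked _<_ r → ColumnsIncreasing (r ∷ rs) →
  FPFInvWord (rowWord rs ++ r ++ S) → DiagEven r
diagonal-entry-even [] rs S _ _ _ = tt
diagonal-entry-even (x ∷ rt) rs S increasing columns fpf =
  letter-after-large-letters-even x (rowWord rs) (rt ++ S) large fpf
  where
  large : All (suc x <_) (rowWord rs)
  large = all-rowWord rs (rows-below (x ∷ rt) rs (row-exceeds-head rt increasing) columns)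

-- The theorem, generalised over a suffix S already read after row(T).
diagonals-even : ∀ T S → All (Linked _<_) T → ColumnsIncreasing T →
  FPFInvWord (rowWord T ++ S) → All DiagEven T
diagonals-even [] S _ _ _ = []
diagonals-even (r ∷ rs) S (increasing ∷ increasings) columns fpf =
  diagonal-entry-even r rs S increasing columns fpf′
    ∷ diagonals-even rs (r ++ S) increasings (columns-tail r rs columns) fpf′
  where
  regroup : rowWord (r ∷ rs) ++ S ≡ rowWord rs ++ r ++ S
  regroup = trans (cong (_++ S) (rowWord-∷ r rs)) (++-assoc (rowWord rs) r S)
  fpf′ : FPFInvWord (rowWord rs ++ r ++ S)
  fpf′ = subst FPFInvWord regroup fpf

lemmaA1 : (lam : List ℕ) (T : List (List ℕ)) →
    IncreasingShiftedTableau lam T → FPFInvWord (rowWord T) → All DiagEven T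
lemmaA1 lam T (_ , _ , _ , increasing , columns) fpf =
  diagonals-even T [] increasing columns (subst FPFInvWord (sym (++-identityʳ (rowWord T))) fpf)
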